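{- Let $T$ be a meet-tree. Suppose $f,g$ are partial automorphisms of $T$ such that $\operatorname{dom}(f)$ and $\operatorname{dom}(g)$ are closed under $\mathbin{\wedge}$, and for every $\eta\in \operatorname{dom}(f)$ there is some $a_\eta\in \operatorname{dom}(g)$ such that $a_\eta\geq \eta$ and $g\restriction_{T_{\leq a_\eta}}\subseteq f$. Then $f\cup g$ is a partial automorphism of $T$ (whose domain is closed under $\mathbin{\wedge}$).
   Context: A meet-tree is a partial order in which the set of elements below any element is linearly ordered, any two elements have a common lower bound, equipped with the meet $\mathbin{\wedge}$ (greatest common lower bound). A partial automorphism is a partial map preserving quantifier-free types in the language $\{\leq,\mathbin{\wedge}\}$; $\operatorname{dom}(f)$ denotes its domain. $T_{\leq a}=\{t\in T: t\leq a\}$. -}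

module Defs where

open import Level using (Level; _⊔_; suc)
open import Data.Nat using (ℕ)
open import Data.Fin using (Fin)
open import Data.Sum using (_⊎_)
open import Data.Product using (_×_; ∃)
open import Relation.Binary.PropositionalEquality using (_≡_)
open import Relation.Binary.Structures using (IsPartialOrder)
open import Function.Bundles using (_⇔_)

record MeetTree (c ℓ : Level) : Set (suc (c ⊔ ℓ)) where
  infix 4 _≤_
  infixl 7 _∧_
  field
    Carrier        : Set c
    _≤_            : Carrier → Carrier → Set ℓ
    isPartialOrder : IsPartialOrder _≡_ _≤_
    lowerLinear    : ∀ a x y → x ≤ a → y ≤ a → (x ≤ y) ⊎ (y ≤ x)
    commonLower    : ∀ x y → ∃ λ z → (z ≤ x) × (z ≤ y)
    _∧_            : Carrier → Carrier → Carrier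
    ∧-≤ˡ           : ∀ x y → x ∧ y ≤ x
    ∧-≤ʳ           : ∀ x y → x ∧ y ≤ y
    ∧-greatest     : ∀ x y z → z ≤ x → z ≤ y → z ≤ x ∧ y

data Term (n : ℕ) : Set where
  var : Fin n → Term n
  _⊓_ : Term n → Term n → Term n

module _ {c ℓ : Level} (T : MeetTree c ℓ) where
  open MeetTree T

  eval : ∀ {n} → (Fin n → Carrier) → Term n → Carrier
  eval xs (var i) = xs i
  eval xs (s ⊓ t) = eval xs s ∧ eval xs t

  -- A partial map on T, given by its graph R (R x y means "x ∈ dom, f(x) = y").
  Rel : Set (suc c)
  Rel = Carrier → Carrier → Set c

  dom : Rel → Carrier → Set c
  dom R x = ∃ λ y → R x y

  Functional : Rel → Set c
  Functional R = ∀ x y z → R x y → R x z → y ≡ z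

  PreservesQFTypes : Rel → Set (c ⊔ ℓ)
  PreservesQFTypes R =
    ∀ (n : ℕ) (xs ys : Fin n → Carrier) → (∀ i → R (xs i) (ys i)) →
    ∀ (s t : Term n) →
      ((eval xs s ≤ eval xs t) ⇔ (eval ys s ≤ eval ys t)) ×
      ((eval xs s ≡ eval xs t) ⇔ (eval ys s ≡ eval ys t))

  IsPartialAutomorphism : Rel → Set (c ⊔ ℓ)
  IsPartialAutomorphism R = Functional R × PreservesQFTypes R

  ClosedUnder∧ : (Carrier → Set c) → Set c
  ClosedUnder∧ D = ∀ x y → D x → D y → D (x ∧ y)

  _∪_ : Rel → Rel → Rel
  (F ∪ G) x y = F x y ⊎ G x y

  RestrictedSubset : Rel → Carrier → Rel → Set (c ⊔ ℓ)
  RestrictedSubset G a F = ∀ x y → x ≤ a → G x y → F x y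

-- A partial map of a meet-tree preserves quantifier-free types as soon as it
-- is an order isomorphism between domain and image whose graph is closed
-- under the pairwise meet; functionality and the equality clauses follow by
-- antisymmetry, and every term is then computed inside the graph.  Both
-- properties pass to f ∪ g by comparing a point x ∈ dom f with y ∈ dom g
-- through the anchor a ≥ x: f contains g below a, so x ∧ y = x ∧ (a ∧ y) and
-- x ≤ y ⇔ x ≤ a ∧ y are decided inside f alone.
module Submission where

open import Defs
open import Level using (Level; _⊔_)
open import Data.Fin using (zero; suc)
open import Data.Product using (_×_; ∃; _,_; proj₁; proj₂)
open import Data.Sum using (inj₁; inj₂)
open import Data.Vec.Functional using (Vector; []; _∷_)
open import Data.Vec.Functional.Relation.Binary.Pointwise using (Pointwise)
open import Relation.Binary.PropositionalEquality using (_≡_; refl; sym; subst; subst₂)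
open import Relation.Binary.Structures using (IsPartialOrder)
open import Function.Bundles using (_⇔_; mk⇔; Equivalence)
import Function.Properties.Equivalence as ⇔

module MeetTreeProperties {c ℓ : Level} (T : MeetTree c ℓ) where
  open MeetTree T
  open IsPartialOrder isPartialOrder
    using (antisym; reflexive) renaming (refl to ≤-refl; trans to ≤-trans)

  ∧-comm : ∀ x y → x ∧ y ≡ y ∧ x
  ∧-comm x y = antisym (∧-greatest y x (x ∧ y) (∧-≤ʳ x y) (∧-≤ˡ x y))
                       (∧-greatest x y (y ∧ x) (∧-≤ʳ y x) (∧-≤ˡ y x))

  ∧-absorbs-upper : ∀ {x y} z → x ≤ y → x ∧ (y ∧ z) ≡ x ∧ z
  ∧-absorbs-upper {x} {y} z x≤y = antisym
    (∧-greatest x z _ (∧-≤ˡ x _) (≤-trans (∧-≤ʳ x _) (∧-≤ʳ y z)))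
    (∧-greatest x (y ∧ z) _ (∧-≤ˡ x z)
      (∧-greatest y z _ (≤-trans (∧-≤ˡ x z) x≤y) (∧-≤ʳ x z)))

  ≤-∧-upper⇔ : ∀ {x y} z → x ≤ y → (x ≤ y ∧ z ⇔ x ≤ z)
  ≤-∧-upper⇔ {x} {y} z x≤y =
    mk⇔ (λ x≤y∧z → ≤-trans x≤y∧z (∧-≤ʳ y z)) (∧-greatest y z x x≤y)

  OrderIsomorphicGraph : Rel T → Set (c ⊔ ℓ)
  OrderIsomorphicGraph R = ∀ {x u y v} → R x u → R y v → (x ≤ y ⇔ u ≤ v)

  MeetClosedGraph : Rel T → Set c
  MeetClosedGraph R = ∀ {x u y v} → R x u → R y v → R (x ∧ y) (u ∧ v)

  module _ {R : Rel T} (preserves : PreservesQFTypes T R) where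

    pointwise-∷ : ∀ {n x u} {xs us : Vector Carrier n} →
                  R x u → Pointwise R xs us → Pointwise R (x ∷ xs) (u ∷ us)
    pointwise-∷ r rs zero    = r
    pointwise-∷ r rs (suc i) = rs i

    preserves⇒orderIsomorphic : OrderIsomorphicGraph R
    preserves⇒orderIsomorphic {x} {u} {y} {v} r s =
      proj₁ (preserves 2 (x ∷ y ∷ []) (u ∷ v ∷ [])
                       (pointwise-∷ r (pointwise-∷ s λ ()))
                       (var zero) (var (suc zero)))

    preserves⇒image-of-∧ : ∀ {x u y v w} → R x u → R y v → R (x ∧ y) w → w ≡ u ∧ v
    preserves⇒image-of-∧ {x} {u} {y} {v} {w} r s t = sym (Equivalence.to
      (proj₂ (preserves 3 (x ∷ y ∷ x ∧ y ∷ []) (u ∷ v ∷ w ∷ [])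
                        (pointwise-∷ r (pointwise-∷ s (pointwise-∷ t λ ())))
                        (var zero ⊓ var (suc zero)) (var (suc (suc zero)))))
      refl)

    closedDom⇒meetClosedGraph : ClosedUnder∧ T (dom T R) → MeetClosedGraph R
    closedDom⇒meetClosedGraph closed {x} {u} {y} {v} r s
      with closed x y (u , r) (v , s)
    ... | w , t = subst (R (x ∧ y)) (preserves⇒image-of-∧ r s t) t

  module _ {R : Rel T} (iso : OrderIsomorphicGraph R) (meet : MeetClosedGraph R) where

    eval-graph : ∀ {n} {xs ys : Vector Carrier n} → Pointwise R xs ys →
                 ∀ t → R (eval T xs t) (eval T ys t)
    eval-graph rs (var i) = rs i
    eval-graph rs (s ⊓ t) = meet (eval-graph rs s) (eval-graph rs t)

    orderIsomorphic⇒≡⇔≡ : ∀ {x u y v} → R x u → R y v → (x ≡ y ⇔ u ≡ v)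
    orderIsomorphic⇒≡⇔≡ r s = mk⇔
      (λ x≡y → antisym (Equivalence.to (iso r s) (reflexive x≡y))
                       (Equivalence.to (iso s r) (reflexive (sym x≡y))))
      (λ u≡v → antisym (Equivalence.from (iso r s) (reflexive u≡v))
                       (Equivalence.from (iso s r) (reflexive (sym u≡v))))

    orderIsomorphic∧meetClosed⇒partialAutomorphism :
      IsPartialAutomorphism T R × ClosedUnder∧ T (dom T R)
    orderIsomorphic∧meetClosed⇒partialAutomorphism =
      (functional , preservesQFTypes) , closed
      where
      functional : Functional T R
      functional x u v r s = Equivalence.to (orderIsomorphic⇒≡⇔≡ r s) refl

      preservesQFTypes : PreservesQFTypes T R
      preservesQFTypes n xs ys rs s t =
        iso (eval-graph rs s) (eval-graph rs t) ,
        orderIsomorphic⇒≡⇔≡ (eval-graph rs s) (eval-graph rs t)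

      closed : ClosedUnder∧ T (dom T R)
      closed x y (u , r) (v , s) = u ∧ v , meet r s

module Union {c ℓ : Level} (T : MeetTree c ℓ) (F G : Rel T) where
  open MeetTree T
  open MeetTreeProperties T
  open IsPartialOrder isPartialOrder using () renaming (refl to ≤-refl; trans to ≤-trans)

  record Anchor (x u : Carrier) : Set (c ⊔ ℓ) where
    field
      a b   : Carrier
      a↦b   : G a b
      x≤a   : x ≤ a
      u≤b   : u ≤ b
      G≤a⊆F : RestrictedSubset T G a F

  module _ (isoF : OrderIsomorphicGraph F) (isoG : OrderIsomorphicGraph G)
           (meetF : MeetClosedGraph F) (meetG : MeetClosedGraph G)
           (anchored : ∀ η → dom T F η →
             ∃ λ a → dom T G a × η ≤ a × RestrictedSubset T G a F) where

    anchor : ∀ {x u} → F x u → Anchor x u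
    anchor {x} {u} fx with anchored x (u , fx)
    ... | a , (b , gab) , x≤a , G≤a⊆F = record
      { a = a ; b = b ; a↦b = gab ; x≤a = x≤a ; G≤a⊆F = G≤a⊆F
      ; u≤b = Equivalence.to (isoF fx (G≤a⊆F a b ≤-refl gab)) x≤a }

    module _ {x u y v} (fx : F x u) (gy : G y v) where
      open Anchor (anchor fx)

      a∧y↦b∧v : F (a ∧ y) (b ∧ v)
      a∧y↦b∧v = G≤a⊆F _ _ (∧-≤ˡ a y) (meetG a↦b gy)

      FG-orderIsomorphic : x ≤ y ⇔ u ≤ v
      FG-orderIsomorphic = ⇔.trans (⇔.sym (≤-∧-upper⇔ y x≤a))
        (⇔.trans (isoF fx a∧y↦b∧v) (≤-∧-upper⇔ v u≤b))

      FG-meet : F (x ∧ y) (u ∧ v)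
      FG-meet = subst₂ F (∧-absorbs-upper y x≤a) (∧-absorbs-upper v u≤b)
                         (meetF fx a∧y↦b∧v)

    GF-orderIsomorphic : ∀ {x u y v} → G x u → F y v → (x ≤ y ⇔ u ≤ v)
    GF-orderIsomorphic {x} {u} gx fy = mk⇔
      (λ x≤y → Equivalence.to (isoF (F-below (≤-trans x≤y y≤a)) fy) x≤y)
      (λ u≤v → Equivalence.from
        (isoF (F-below (Equivalence.from (isoG gx a↦b) (≤-trans u≤v v≤b))) fy) u≤v)
      where
      open Anchor (anchor fy) renaming (x≤a to y≤a; u≤b to v≤b)
      F-below : x ≤ a → F x u
      F-below x≤a = G≤a⊆F x u x≤a gx

    union-orderIsomorphic : OrderIsomorphicGraph (_∪_ T F G)
    union-orderIsomorphic (inj₁ fx) (inj₁ fy) = isoF fx fy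
    union-orderIsomorphic (inj₁ fx) (inj₂ gy) = FG-orderIsomorphic fx gy
    union-orderIsomorphic (inj₂ gx) (inj₁ fy) = GF-orderIsomorphic gx fy
    union-orderIsomorphic (inj₂ gx) (inj₂ gy) = isoG gx gy

    union-meetClosed : MeetClosedGraph (_∪_ T F G)
    union-meetClosed (inj₁ fx) (inj₁ fy) = inj₁ (meetF fx fy)
    union-meetClosed (inj₁ fx) (inj₂ gy) = inj₁ (FG-meet fx gy)
    union-meetClosed {x} {u} {y} {v} (inj₂ gx) (inj₁ fy) =
      inj₁ (subst₂ F (∧-comm y x) (∧-comm v u) (FG-meet fy gx))
    union-meetClosed (inj₂ gx) (inj₂ gy) = inj₂ (meetG gx gy)

lemma3p5 : ∀ {c ℓ : Level} (T : MeetTree c ℓ) (F G : Rel T) →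
    IsPartialAutomorphism T F → IsPartialAutomorphism T G →
    ClosedUnder∧ T (dom T F) → ClosedUnder∧ T (dom T G) →
    (∀ η → dom T F η →
      ∃ λ a → dom T G a × MeetTree._≤_ T η a × RestrictedSubset T G a F) →
    IsPartialAutomorphism T (_∪_ T F G) × ClosedUnder∧ T (dom T (_∪_ T F G))
lemma3p5 T F G (_ , qfF) (_ , qfG) closedF closedG anchored =
  orderIsomorphic∧meetClosed⇒partialAutomorphism
    (union-orderIsomorphic isoF isoG meetF meetG anchored)
    (union-meetClosed isoF isoG meetF meetG anchored)
  where
  open MeetTreeProperties T
  open Union T F G
  isoF : OrderIsomorphicGraph F
  isoF = preserves⇒orderIsomorphic qfF
  isoG : OrderIsomorphicGraph G
  isoG = preserves⇒orderIsomorphic qfG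
  meetF : MeetClosedGraph F
  meetF = closedDom⇒meetClosedGraph qfF closedF
  meetG : MeetClosedGraph G
  meetG = closedDom⇒meetClosedGraph qfG closedG
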